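{- For any rational $q$, considering only odd primes $p\notin\mathcal D(q)$: $\Pi_*(q)\setminus\Pi_2(q)\subset\{p:(2|p)=1\}$; $\Pi_2(q)\subset\{p:(2|p)=(2+q|p)=(2-q|p)\}$; $\{p:(2+q|p)=0\}\subset\Pi_1(q)$; and $\{p:(2-q|p)=0\}\subset\Pi_0(q)$.
   Context: Chebyshev polynomials: $U_0=0$, $U_1=1$, $U_{n+1}=qU_n-U_{n-1}$; $C_n=U_{n+1}-U_{n-1}$; for odd $n=2k+1$, $V_n=U_{k+1}-U_k$, $W_n=U_{k+1}+U_k$. For rational $q=a/b$ in lowest terms, $\mathcal D(q)$ is the set of prime divisors of $b$; congruences mod $p\nmid b$ are in $\mathbb F_p$. For an odd prime $p\notin\mathcal D(q)$: $p\in\Pi_0(q)$ if $W_n(q)\equiv0$ for some odd $n\ge1$; $p\in\Pi_1(q)$ if $V_n(q)\equiv0$ for some odd $n\ge1$; $p\in\Pi_{2+k}(q)$ ($k\ge0$) if $C_{2^kn}(q)\equiv0$ for some odd $n\ge1$; $\Pi_*(q)=\bigcup_{k\ge2}\Pi_k(q)$. Legendre symbol of a rational $x=a/b$ (lowest terms) at an odd prime $p\nmid b$: $(x|p)=1$ if $ab$ is a nonzero quadratic residue mod $p$, $-1$ if a nonresidue, $0$ if $p\mid a$. -}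

module Defs where

open import Data.Nat as ℕ using (ℕ; zero; suc; _^_)
open import Data.Nat.Divisibility using (_∣_)
open import Data.Integer as ℤ using (ℤ; +_; -[1+_]; ∣_∣)
open import Data.Integer.DivMod using (_%ℕ_)
open import Data.Rational as ℚ using (ℚ; _/_; 0ℚ; 1ℚ)
open ℚ.ℚ using (numerator; denominatorℕ)
open import Data.Product using (Σ)
open import Data.Bool using (Bool; true; false; if_then_else_)
open import Data.List using (List; upTo)
open import Data.Bool.ListAction using (any)
open import Data.Nat using (_≡ᵇ_)

U : ℕ → ℚ → ℚ
U zero q = 0ℚ
U (suc zero) q = 1ℚ
U (suc (suc n)) q = q ℚ.* U (suc n) q ℚ.- U n q

-- C n = U (n+1) - U (n-1).  (Only used for n ≥ 1; C 0 is set to 2,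
-- consistent with U_{-1} = -1 from the recurrence.)
C : ℕ → ℚ → ℚ
C zero q = + 2 / 1
C (suc n) q = U (suc (suc n)) q ℚ.- U n q

-- For odd n = 2k+1:  V n = U (k+1) - U k,  W n = U (k+1) + U k.
-- Here indexed by k (so V' k q = V_{2k+1}(q)).
V' : ℕ → ℚ → ℚ
V' k q = U (suc k) q ℚ.- U k q

W' : ℕ → ℚ → ℚ
W' k q = U (suc k) q ℚ.+ U k q

odd : ℕ → ℕ
odd k = suc (2 ℕ.* k)

InD : ℕ → ℚ → Set
InD p q = p ∣ denominatorℕ q

-- x ≡ 0 in 𝔽_p, for a rational x (in lowest terms) whose denominator is prime to p:
-- p divides the numerator.
≡0mod : ℚ → ℕ → Set
≡0mod x p = p ∣ ∣ numerator x ∣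

Π₀ : ℚ → ℕ → Set
Π₀ q p = Σ ℕ (λ k → ≡0mod (W' k q) p)
Π₁ : ℚ → ℕ → Set
Π₁ q p = Σ ℕ (λ k → ≡0mod (V' k q) p)
-- Π₂₊ k q p  is  p ∈ Π_{2+k}(q)
Π₂₊ : ℕ → ℚ → ℕ → Set
Π₂₊ k q p = Σ ℕ (λ m → ≡0mod (C (2 ^ k ℕ.* odd m) q) p)
Π* : ℚ → ℕ → Set
Π* q p = Σ ℕ (λ k → Π₂₊ k q p)

-- Legendre symbol of a rational x = a/b (lowest terms) at p (p ∤ b):
-- 0 if p ∣ a; 1 if ab is a nonzero square mod p; -1 otherwise.
legendre : ℚ → ℕ → ℤ
legendre x zero = + 0
legendre x (suc p') =
  let p = suc p'
      r = (numerator x ℤ.* + denominatorℕ x) %ℕ p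
  in if r ≡ᵇ 0 then + 0
     else if any (λ y → ((y ℕ.* y) ℕ.% p) ≡ᵇ r) (upTo p) then + 1
     else -[1+ 0 ]

{-# OPTIONS --safe #-}
-- Since p ∤ den(q), q reduces modulo p to an integer r, and U_n(q), C_n(q), V_n(q), W_n(q) and
-- the Legendre symbols of 2 ± q reduce to the corresponding integer values at r. Everything
-- then follows from the product formula C_{n+d} C_n = C_{2n+d} + C_d. If C_{2M}(r) ≡ 0 then
-- 2 ≡ C_M(r)². If C_n(r) ≡ 0 with n = 2m+1, then 2(2 ± r) ≡ (C_{m+1}(r) ± C_m(r))², and
-- 2 ± r ≢ 0 because C_n(2) = 2 and C_n(-2) = ±2. Finally, writing p = 2k+1, if r ≡ 2 then
-- U_{k+1}(r) + U_k(r) ≡ W_p(2) = p, and if r ≡ -2 then U_{k+1}(r) - U_k(r) ≡ V_p(-2) = ±p.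
module Submission where

open import Data.Bool using (Bool; true; false; if_then_else_; T)
open import Data.Bool.ListAction using (any)
open import Data.Bool.Properties using (T-≡)
open import Data.Empty using (⊥-elim)
open import Data.List using (upTo)
open import Data.List.Relation.Unary.Any using (satisfied)
open import Data.List.Relation.Unary.Any.Properties using (any⁺; any⁻)
open import Data.List.Membership.Propositional using (lose)
open import Data.List.Membership.Propositional.Properties using (∈-upTo⁺)
open import Data.Nat as ℕ using (ℕ; zero; suc; _≡ᵇ_)
import Data.Nat.Properties as ℕ
open import Data.Nat.Divisibility as ℕ∣ using (_∣_)
open import Data.Nat.DivMod using (m≡m%n+[m/n]*n; m%n<n)
open import Data.Nat.GCD using (module Bézout)
open import Data.Nat.Coprimality using (Coprime; coprime-Bézout)
open import Data.Nat.Primality using (Prime; euclidsLemma; prime⇒irreducible; prime⇒nonZero; prime⇒nonTrivial)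
open import Data.Nat.Tactic.RingSolver as ℕ-Solver using ()
open import Data.Integer as ℤ using (ℤ; +_; -[1+_]; _*_; -_; ∣_∣)
import Data.Integer.Properties as ℤ
open import Data.Integer.DivMod using (_%ℕ_; _/ℕ_; a≡a%ℕn+[a/ℕn]*n; n%ℕd<d)
open import Data.Integer.Divisibility.Signed as ℤ∣ using (divides; ∣ᵤ⇒∣; ∣⇒∣ᵤ) renaming (_∣_ to _∣ᶻ_)
open import Data.Integer.Tactic.RingSolver using (solve-∀)
open import Data.Rational as ℚ using (ℚ; _/_; ↥_; ↧_; ↧ₙ_)
open import Data.Rational.Properties using (↥-/; ↧-/; ↥-neg; ↧-neg)
open import Data.Product using (∃; _×_; _,_; proj₁; proj₂)
open import Data.Sum using (_⊎_; inj₁; inj₂)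
open import Function using (_∘_)
open import Function.Bundles using (Equivalence)
open import Relation.Binary.Bundles using (Setoid)
import Relation.Binary.Reasoning.Setoid as SetoidReasoning
open import Relation.Nullary using (¬_; contradiction)
open import Relation.Binary.PropositionalEquality
  using (_≡_; refl; sym; trans; cong; cong₂; subst; subst₂; module ≡-Reasoning)
open import Defs

T-injective : ∀ {x y} → (T x → T y) → (T y → T x) → x ≡ y
T-injective {false} {false} _   _   = refl
T-injective {false} {true}  _   y⇒x = ⊥-elim (y⇒x _)
T-injective {true}  {false} x⇒y _   = ⊥-elim (x⇒y _)
T-injective {true}  {true}  _   _   = refl

prime∤⇒coprime : ∀ {p n} → Prime p → ¬ p ∣ n → Coprime p n
prime∤⇒coprime p-prime p∤n (d∣p , d∣n) with prime⇒irreducible p-prime d∣p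
... | inj₁ d≡1 = d≡1
... | inj₂ refl = contradiction d∣n p∤n

odd-of-¬2∣ : ∀ {n} → ¬ 2 ∣ n → ∃ λ k → n ≡ odd k
odd-of-¬2∣ {zero}          2∤0   = contradiction (ℕ∣._∣0 2) 2∤0
odd-of-¬2∣ {suc zero}      _     = 0 , refl
odd-of-¬2∣ {suc (suc n)}   2∤2+n with odd-of-¬2∣ (2∤2+n ∘ ℕ∣.∣m∣n⇒∣m+n (ℕ∣.∣-refl {2}))
... | k , n≡odd = suc k , trans (cong (2 ℕ.+_) n≡odd) (cong (suc ∘ suc) (sym (ℕ.+-suc k (k ℕ.+ 0))))

module Chebyshev where

  open import Data.Integer using (_+_; _-_)
  open ≡-Reasoning

  u : ℕ → ℤ → ℤ
  u zero          r = + 0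
  u (suc zero)    r = + 1
  u (suc (suc n)) r = r * u (suc n) r - u n r

  c : ℕ → ℤ → ℤ
  c zero    r = + 2
  c (suc n) r = u (suc (suc n)) r - u n r

  c-rec : ∀ n r → c (suc (suc n)) r ≡ r * c (suc n) r - c n r
  c-rec zero    r = identity r
    where identity : ∀ r → (r * (r * + 1 - + 0) - + 1) - + 1 ≡ r * ((r * + 1 - + 0) - + 0) - + 2
          identity = solve-∀
  c-rec (suc n) r = identity r (u (3 ℕ.+ n) r) (u (2 ℕ.+ n) r) (u (suc n) r) (u n r)
    where identity : ∀ r a b c d → (r * a - b) - (r * c - d) ≡ r * (a - c) - (b - d)
          identity = solve-∀

  c-index : ∀ {i j} r → i ≡ j → c i r ≡ c j r
  c-index r = cong (λ i → c i r)

  -- Since C_{n+2} = r C_{n+1} - C_n, the case (n+2, d) follows from the cases (n+1, d+1) and (n, d+2).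
  c[n+d]*c[n]≡c[n+n+d]+c[d] : ∀ n d r → c (n ℕ.+ d) r * c n r ≡ c (n ℕ.+ (n ℕ.+ d)) r + c d r
  c[n+d]*c[n]≡c[n+n+d]+c[d] zero d r = identity (c d r)
    where identity : ∀ x → x * + 2 ≡ x + x
          identity = solve-∀
  c[n+d]*c[n]≡c[n+n+d]+c[d] (suc zero) d r = begin
    c (suc d) r * ((r * + 1 - + 0) - + 0) ≡⟨ identity r (c (suc d) r) (c d r) ⟩
    (r * c (suc d) r - c d r) + c d r     ≡⟨ cong (_+ c d r) (c-rec d r) ⟨
    c (2 ℕ.+ d) r + c d r                 ∎
    where identity : ∀ r x y → x * ((r * + 1 - + 0) - + 0) ≡ (r * x - y) + y
          identity = solve-∀
  c[n+d]*c[n]≡c[n+n+d]+c[d] (suc (suc n)) d r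
    with c[n+d]*c[n]≡c[n+n+d]+c[d] (suc n) (suc d) r | c[n+d]*c[n]≡c[n+n+d]+c[d] n (2 ℕ.+ d) r
  ... | hyp₁ | hyp₂ = begin
    c′ m * c′ (2 ℕ.+ n)                                   ≡⟨ cong (c′ m *_) (c-rec n r) ⟩
    c′ m * (r * c′ (suc n) - c′ n)                         ≡⟨ distrib r (c′ m) (c′ (suc n)) (c′ n) ⟩
    r * (c′ m * c′ (suc n)) - c′ m * c′ n                   ≡⟨ cong₂ (λ x y → r * x - y) ih₁ ih₂ ⟩
    r * (c′ (3 ℕ.+ j) + c′ (suc d)) - (c′ (2 ℕ.+ j) + c′ (2 ℕ.+ d))
      ≡⟨ cong (λ y → r * (c′ (3 ℕ.+ j) + c′ (suc d)) - (c′ (2 ℕ.+ j) + y)) (c-rec d r) ⟩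
    r * (c′ (3 ℕ.+ j) + c′ (suc d)) - (c′ (2 ℕ.+ j) + (r * c′ (suc d) - c′ d))
      ≡⟨ regroup r (c′ (3 ℕ.+ j)) (c′ (2 ℕ.+ j)) (c′ (suc d)) (c′ d) ⟩
    (r * c′ (3 ℕ.+ j) - c′ (2 ℕ.+ j)) + c′ d               ≡⟨ cong (_+ c′ d) (c-rec (2 ℕ.+ j) r) ⟨
    c′ (4 ℕ.+ j) + c′ d                                   ≡⟨ cong (λ i → c′ i + c′ d) (4+j≡ n d) ⟩
    c′ (2 ℕ.+ n ℕ.+ (2 ℕ.+ n ℕ.+ d)) + c′ d               ∎
    where
    c′ : ℕ → ℤ
    c′ i = c i r
    m = 2 ℕ.+ n ℕ.+ d
    j = n ℕ.+ (n ℕ.+ d)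
    m≡ : ∀ n d → suc n ℕ.+ suc d ≡ 2 ℕ.+ n ℕ.+ d
    m≡ = ℕ-Solver.solve-∀
    m≡′ : ∀ n d → n ℕ.+ (2 ℕ.+ d) ≡ 2 ℕ.+ n ℕ.+ d
    m≡′ = ℕ-Solver.solve-∀
    3+j≡ : ∀ n d → suc n ℕ.+ (suc n ℕ.+ suc d) ≡ 3 ℕ.+ (n ℕ.+ (n ℕ.+ d))
    3+j≡ = ℕ-Solver.solve-∀
    2+j≡ : ∀ n d → n ℕ.+ (n ℕ.+ (2 ℕ.+ d)) ≡ 2 ℕ.+ (n ℕ.+ (n ℕ.+ d))
    2+j≡ = ℕ-Solver.solve-∀
    4+j≡ : ∀ n d → 4 ℕ.+ (n ℕ.+ (n ℕ.+ d)) ≡ 2 ℕ.+ n ℕ.+ (2 ℕ.+ n ℕ.+ d)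
    4+j≡ = ℕ-Solver.solve-∀
    ih₁ : c′ m * c′ (suc n) ≡ c′ (3 ℕ.+ j) + c′ (suc d)
    ih₁ = subst₂ (λ i k → c′ i * c′ (suc n) ≡ c′ k + c′ (suc d)) (m≡ n d) (3+j≡ n d) hyp₁
    ih₂ : c′ m * c′ n ≡ c′ (2 ℕ.+ j) + c′ (2 ℕ.+ d)
    ih₂ = subst₂ (λ i k → c′ i * c′ n ≡ c′ k + c′ (2 ℕ.+ d)) (m≡′ n d) (2+j≡ n d) hyp₂
    distrib : ∀ r x y z → x * (r * y - z) ≡ r * (x * y) - x * z
    distrib = solve-∀
    regroup : ∀ r a b x y → r * (a + x) - (b + (r * x - y)) ≡ (r * a - b) + y
    regroup = solve-∀

  c[n]²≡c[2n]+2 : ∀ n r → c n r * c n r ≡ c (2 ℕ.* n) r + + 2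
  c[n]²≡c[2n]+2 n r = subst₂ (λ i j → c i r * c n r ≡ c j r + + 2) (ℕ.+-identityʳ n) (n+[n+0]≡2n n)
                         (c[n+d]*c[n]≡c[n+n+d]+c[d] n 0 r)
    where n+[n+0]≡2n : ∀ n → n ℕ.+ (n ℕ.+ 0) ≡ 2 ℕ.* n
          n+[n+0]≡2n = ℕ-Solver.solve-∀

  -- From the product formula with d = 0 (for C_m² and C_{m+1}²) and d = 1 (for C_{m+1} C_m).
  module _ (m : ℕ) (r : ℤ) where
    private
      A = c (suc m) r
      B = c m r
      X = c (2 ℕ.* m) r
      Y = c (odd m) r
      A² : A * A ≡ (r * Y - X) + + 2
      A² = begin
        A * A                             ≡⟨ c[n]²≡c[2n]+2 (suc m) r ⟩
        c (2 ℕ.* suc m) r + + 2           ≡⟨ cong (λ i → c i r + + 2) (ℕ.*-suc 2 m) ⟩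
        c (2 ℕ.+ 2 ℕ.* m) r + + 2         ≡⟨ cong (_+ + 2) (c-rec (2 ℕ.* m) r) ⟩
        (r * Y - X) + + 2                 ∎
      B² : B * B ≡ X + + 2
      B² = c[n]²≡c[2n]+2 m r
      AB : A * B ≡ Y + r
      AB = begin
        A * B                             ≡⟨ cong (_* B) (c-index r (ℕ.+-comm 1 m)) ⟩
        c (m ℕ.+ 1) r * B                 ≡⟨ c[n+d]*c[n]≡c[n+n+d]+c[d] m 1 r ⟩
        c (m ℕ.+ (m ℕ.+ 1)) r + c 1 r     ≡⟨ cong₂ _+_ (c-index r (m+[m+1]≡odd m)) (c[1]≡r r) ⟩
        Y + r                             ∎
        where m+[m+1]≡odd : ∀ m → m ℕ.+ (m ℕ.+ 1) ≡ suc (2 ℕ.* m)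
              m+[m+1]≡odd = ℕ-Solver.solve-∀
              c[1]≡r : ∀ r → (r * + 1 - + 0) - + 0 ≡ r
              c[1]≡r = solve-∀

    c-sum-square : (c (suc m) r + c m r) * (c (suc m) r + c m r) ≡ + 2 * (+ 2 + r) + (r + + 2) * c (odd m) r
    c-sum-square = begin
      (A + B) * (A + B)                 ≡⟨ expand A B ⟩
      A * A + B * B + + 2 * (A * B)     ≡⟨ cong₂ (λ x y → x + + 2 * y) (cong₂ _+_ A² B²) AB ⟩
      (r * Y - X) + + 2 + (X + + 2) + + 2 * (Y + r) ≡⟨ collect X Y r ⟩
      + 2 * (+ 2 + r) + (r + + 2) * Y   ∎
      where
      expand : ∀ A B → (A + B) * (A + B) ≡ A * A + B * B + + 2 * (A * B)
      expand = solve-∀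
      collect : ∀ X Y r → (r * Y - X) + + 2 + (X + + 2) + + 2 * (Y + r) ≡ + 2 * (+ 2 + r) + (r + + 2) * Y
      collect = solve-∀

    c-difference-square : (c (suc m) r - c m r) * (c (suc m) r - c m r) ≡ + 2 * (+ 2 - r) + (r - + 2) * c (odd m) r
    c-difference-square = begin
      (A - B) * (A - B)                 ≡⟨ expand A B ⟩
      A * A + B * B - + 2 * (A * B)     ≡⟨ cong₂ (λ x y → x - + 2 * y) (cong₂ _+_ A² B²) AB ⟩
      (r * Y - X) + + 2 + (X + + 2) - + 2 * (Y + r) ≡⟨ collect X Y r ⟩
      + 2 * (+ 2 - r) + (r - + 2) * Y   ∎
      where
      expand : ∀ A B → (A - B) * (A - B) ≡ A * A + B * B - + 2 * (A * B)
      expand = solve-∀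
      collect : ∀ X Y r → (r * Y - X) + + 2 + (X + + 2) - + 2 * (Y + r) ≡ + 2 * (+ 2 - r) + (r - + 2) * Y
      collect = solve-∀

  u-at-2 : ∀ k → u k (+ 2) ≡ + k
  u-at-2 zero          = refl
  u-at-2 (suc zero)    = refl
  u-at-2 (suc (suc k)) = begin
    + 2 * u (suc k) (+ 2) - u k (+ 2) ≡⟨ cong₂ (λ x y → + 2 * x - y) (u-at-2 (suc k)) (u-at-2 k) ⟩
    + 2 * + suc k - + k               ≡⟨ cong (λ x → + 2 * x - + k) (ℤ.pos-+ 1 k) ⟩
    + 2 * (+ 1 + + k) - + k           ≡⟨ identity (+ k) ⟩
    + 2 + + k                         ≡⟨ ℤ.pos-+ 2 k ⟨
    + suc (suc k)                     ∎
    where identity : ∀ k → + 2 * (+ 1 + k) - k ≡ + 2 + k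
          identity = solve-∀

  c-at-2 : ∀ n → c n (+ 2) ≡ + 2
  c-at-2 zero    = refl
  c-at-2 (suc n) = begin
    u (2 ℕ.+ n) (+ 2) - u n (+ 2) ≡⟨ cong₂ _-_ (u-at-2 (2 ℕ.+ n)) (u-at-2 n) ⟩
    + (2 ℕ.+ n) - + n             ≡⟨ cong (_- + n) (ℤ.pos-+ 2 n) ⟩
    + 2 + + n - + n               ≡⟨ identity (+ n) ⟩
    + 2                           ∎
    where identity : ∀ n → + 2 + n - n ≡ + 2
          identity = solve-∀

  private
    neg*neg : ∀ s → - s * - s ≡ s * s
    neg*neg = solve-∀

  -- U_k(-2) = (-1)^{k+1} k; the sign is carried as a unit s.
  u-at-−2 : ∀ k → ∃ λ s → s * s ≡ + 1 × u k (- + 2) ≡ - (s * + k) × u (suc k) (- + 2) ≡ s * + suc k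
  u-at-−2 zero    = + 1 , refl , refl , refl
  u-at-−2 (suc k) with u-at-−2 k
  ... | s , s²≡1 , uₖ , uₖ₊₁ = - s , trans (neg*neg s) s²≡1 , uₖ₊₁′ , uₖ₊₂
    where
    uₖ₊₁′ : u (suc k) (- + 2) ≡ - (- s * + suc k)
    uₖ₊₁′ = trans uₖ₊₁ (identity s (+ suc k))
      where identity : ∀ s x → s * x ≡ - (- s * x)
            identity = solve-∀
    uₖ₊₂ : u (2 ℕ.+ k) (- + 2) ≡ - s * + (2 ℕ.+ k)
    uₖ₊₂ = begin
      - + 2 * u (suc k) (- + 2) - u k (- + 2) ≡⟨ cong₂ (λ x y → - + 2 * x - y) uₖ₊₁ uₖ ⟩
      - + 2 * (s * + suc k) - - (s * + k)     ≡⟨ cong (λ x → - + 2 * (s * x) - - (s * + k)) (ℤ.pos-+ 1 k) ⟩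
      - + 2 * (s * (+ 1 + + k)) - - (s * + k) ≡⟨ identity s (+ k) ⟩
      - s * (+ 2 + + k)                       ≡⟨ cong (- s *_) (ℤ.pos-+ 2 k) ⟨
      - s * + (2 ℕ.+ k)                       ∎
      where identity : ∀ s k → - + 2 * (s * (+ 1 + k)) - - (s * k) ≡ - s * (+ 2 + k)
            identity = solve-∀

  c-at-−2 : ∀ n → ∃ λ s → s * s ≡ + 1 × c n (- + 2) ≡ s * + 2
  c-at-−2 zero    = + 1 , refl , refl
  c-at-−2 (suc n) with u-at-−2 n
  ... | s , s²≡1 , uₙ , uₙ₊₁ = - s , trans (neg*neg s) s²≡1 , (begin
    - + 2 * u (suc n) (- + 2) - u n (- + 2) - u n (- + 2)
       ≡⟨ cong₂ (λ x y → - + 2 * x - y - y) uₙ₊₁ uₙ ⟩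
    - + 2 * (s * + suc n) - - (s * + n) - - (s * + n)
       ≡⟨ cong (λ x → - + 2 * (s * x) - - (s * + n) - - (s * + n)) (ℤ.pos-+ 1 n) ⟩
    - + 2 * (s * (+ 1 + + n)) - - (s * + n) - - (s * + n)
       ≡⟨ identity s (+ n) ⟩
    - s * + 2 ∎)
    where
    identity : ∀ s n → - + 2 * (s * (+ 1 + n)) - - (s * n) - - (s * n) ≡ - s * + 2
    identity = solve-∀

  W-at-2 : ∀ k → u (suc k) (+ 2) + u k (+ 2) ≡ + odd k
  W-at-2 k = begin
    u (suc k) (+ 2) + u k (+ 2) ≡⟨ cong₂ _+_ (u-at-2 (suc k)) (u-at-2 k) ⟩
    + suc k + + k               ≡⟨ ℤ.pos-+ (suc k) k ⟨
    + (suc k ℕ.+ k)             ≡⟨ cong +_ (1+k+k≡odd k) ⟩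
    + odd k                     ∎
    where 1+k+k≡odd : ∀ k → suc k ℕ.+ k ≡ suc (2 ℕ.* k)
          1+k+k≡odd = ℕ-Solver.solve-∀

  V-at-−2 : ∀ k → ∃ λ s → u (suc k) (- + 2) - u k (- + 2) ≡ s * + odd k
  V-at-−2 k with u-at-−2 k
  ... | s , _ , uₖ , uₖ₊₁ = s , (begin
    u (suc k) (- + 2) - u k (- + 2) ≡⟨ cong₂ _-_ uₖ₊₁ uₖ ⟩
    s * + suc k - - (s * + k)       ≡⟨ identity s (+ suc k) (+ k) ⟩
    s * (+ suc k + + k)             ≡⟨ cong (s *_) (ℤ.pos-+ (suc k) k) ⟨
    s * + (suc k ℕ.+ k)             ≡⟨ cong (λ n → s * + n) (1+k+k≡odd k) ⟩
    s * + odd k                     ∎)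
    where identity : ∀ s a b → s * a - - (s * b) ≡ s * (a + b)
          identity = solve-∀
          1+k+k≡odd : ∀ k → suc k ℕ.+ k ≡ suc (2 ℕ.* k)
          1+k+k≡odd = ℕ-Solver.solve-∀

open Chebyshev

module Congruence (m : ℤ) where

  open import Data.Integer using (_+_; _-_)

  infix 4 _≈_
  record _≈_ (a b : ℤ) : Set where
    constructor mk≈
    field ∣-difference : m ∣ᶻ a - b

  private
    resp : ∀ {a b} → a ≡ b → m ∣ᶻ a → m ∣ᶻ b
    resp = subst (m ∣ᶻ_)

    ∣0 : m ∣ᶻ + 0
    ∣0 = divides (+ 0) refl

  ≡+*⇒≈ : ∀ {a b} k → a ≡ b + k * m → a ≈ b
  ≡+*⇒≈ {a} {b} k refl = mk≈ (divides k (identity b (k * m)))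
    where identity : ∀ b x → b + x - b ≡ x
          identity = solve-∀

  ≈0⇒∣ : ∀ {a} → a ≈ + 0 → m ∣ᶻ a
  ≈0⇒∣ {a} (mk≈ d) = resp (ℤ.+-identityʳ a) d

  ≈-refl : ∀ {a} → a ≈ a
  ≈-refl {a} = mk≈ (resp (sym (ℤ.+-inverseʳ a)) ∣0)

  ≈-sym : ∀ {a b} → a ≈ b → b ≈ a
  ≈-sym {a} {b} (mk≈ d) = mk≈ (resp (identity a b) (ℤ∣.∣m⇒∣-m d))
    where identity : ∀ a b → - (a - b) ≡ b - a
          identity = solve-∀

  ≈-trans : ∀ {a b c} → a ≈ b → b ≈ c → a ≈ c
  ≈-trans {a} {b} {c} (mk≈ d) (mk≈ e) = mk≈ (resp (identity a b c) (ℤ∣.∣m∣n⇒∣m+n d e))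
    where identity : ∀ a b c → (a - b) + (b - c) ≡ a - c
          identity = solve-∀

  ≈-reflexive : ∀ {a b} → a ≡ b → a ≈ b
  ≈-reflexive refl = ≈-refl

  ≈-setoid : Setoid _ _
  ≈-setoid = record
    { _≈_ = _≈_
    ; isEquivalence = record { refl = ≈-refl ; sym = ≈-sym ; trans = ≈-trans }
    }

  module ≈-Reasoning = SetoidReasoning ≈-setoid

  +-cong : ∀ {a b c d} → a ≈ b → c ≈ d → a + c ≈ b + d
  +-cong {a} {b} {c} {d} (mk≈ e) (mk≈ f) = mk≈ (resp (identity a b c d) (ℤ∣.∣m∣n⇒∣m+n e f))
    where identity : ∀ a b c d → (a - b) + (c - d) ≡ (a + c) - (b + d)
          identity = solve-∀

  neg-cong : ∀ {a b} → a ≈ b → - a ≈ - b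
  neg-cong {a} {b} (mk≈ e) = mk≈ (resp (identity a b) (ℤ∣.∣m⇒∣-m e))
    where identity : ∀ a b → - (a - b) ≡ - a - - b
          identity = solve-∀

  *-cong : ∀ {a b c d} → a ≈ b → c ≈ d → a * c ≈ b * d
  *-cong {a} {b} {c} {d} (mk≈ e) (mk≈ f) =
    mk≈ (resp (identity a b c d) (ℤ∣.∣m∣n⇒∣m+n (ℤ∣.∣m⇒∣m*n c e) (ℤ∣.∣n⇒∣m*n b f)))
    where identity : ∀ a b c d → (a - b) * c + b * (c - d) ≡ a * c - b * d
          identity = solve-∀

  +∣≈ : ∀ {a b} → m ∣ᶻ b → a + b ≈ a
  +∣≈ {a} {b} m∣b = mk≈ (resp (identity a b) m∣b)
    where identity : ∀ a b → b ≡ a + b - a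
          identity = solve-∀

  ∣-resp-≈ : ∀ {a b} → a ≈ b → m ∣ᶻ b → m ∣ᶻ a
  ∣-resp-≈ {a} {b} (mk≈ e) f = resp (identity a b) (ℤ∣.∣m∣n⇒∣m+n e f)
    where identity : ∀ a b → (a - b) + b ≡ a
          identity = solve-∀

module ModPrime (p : ℕ) (p-prime : Prime p) where

  open import Data.Integer using (_+_; _-_)

  open Congruence (+ p) public

  instance
    p≢0 : ℕ.NonZero p
    p≢0 = prime⇒nonZero p-prime

  p∤1 : ¬ + p ∣ᶻ + 1
  p∤1 p∣1 = ℕ.<⇒≱ (ℕ.nonTrivial⇒n>1 p {{prime⇒nonTrivial p-prime}}) (ℕ∣.∣⇒≤ (∣⇒∣ᵤ p∣1))

  odd⇒p∤2 : ¬ 2 ∣ p → ¬ + p ∣ᶻ + 2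
  odd⇒p∤2 2∤p p∣2 = 2∤p (ℕ∣.∣-reflexive 2≡p)
    where 2≡p : 2 ≡ p
          2≡p = ℕ.≤-antisym (ℕ.nonTrivial⇒n>1 p {{prime⇒nonTrivial p-prime}}) (ℕ∣.∣⇒≤ (∣⇒∣ᵤ p∣2))

  ∣-* : ∀ {a b} → + p ∣ᶻ a * b → + p ∣ᶻ a ⊎ + p ∣ᶻ b
  ∣-* {a} {b} d with euclidsLemma ∣ a ∣ ∣ b ∣ p-prime (subst (p ∣_) (ℤ.abs-* a b) (∣⇒∣ᵤ d))
  ... | inj₁ p∣a = inj₁ (∣ᵤ⇒∣ p∣a)
  ... | inj₂ p∣b = inj₂ (∣ᵤ⇒∣ p∣b)

  ∤-* : ∀ {a b} → ¬ + p ∣ᶻ a → ¬ + p ∣ᶻ b → ¬ + p ∣ᶻ a * b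
  ∤-* p∤a p∤b d with ∣-* d
  ... | inj₁ p∣a = p∤a p∣a
  ... | inj₂ p∣b = p∤b p∣b

  private
    lift : ∀ a b c d → 1 ℕ.+ a ℕ.* b ≡ c ℕ.* d → + 1 + + a * + b ≡ + c * + d
    lift a b c d eq = begin
      + 1 + + a * + b      ≡⟨ cong (_+_ (+ 1)) (ℤ.pos-* a b) ⟨
      + (1 ℕ.+ a ℕ.* b)    ≡⟨ cong +_ eq ⟩
      + (c ℕ.* d)          ≡⟨ ℤ.pos-* c d ⟩
      + c * + d            ∎
      where open ≡-Reasoning

    inverse-ℕ : ∀ {n} → ¬ p ∣ n → ∃ λ w → + n * w ≈ + 1
    inverse-ℕ {n} p∤n with coprime-Bézout (prime∤⇒coprime p-prime p∤n)
    ... | Bézout.+- x y eq = - + y , ≡+*⇒≈ (- + x) (begin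
      + n * - + y               ≡⟨ identity (+ n) (+ y) ⟩
      + 1 + - (+ 1 + + y * + n) ≡⟨ cong (λ t → + 1 + - t) (lift y n x p eq) ⟩
      + 1 + - (+ x * + p)       ≡⟨ cong (_+_ (+ 1)) (ℤ.neg-distribˡ-* (+ x) (+ p)) ⟩
      + 1 + - + x * + p         ∎)
      where open ≡-Reasoning
            identity : ∀ n y → n * - y ≡ + 1 + - (+ 1 + y * n)
            identity = solve-∀
    ... | Bézout.-+ x y eq = + y , ≡+*⇒≈ (+ x) (trans (ℤ.*-comm (+ n) (+ y)) (sym (lift x p y n eq)))

  inverse : ∀ {a} → ¬ + p ∣ᶻ a → ∃ λ w → a * w ≈ + 1
  inverse {+ n}      p∤a = inverse-ℕ (p∤a ∘ ∣ᵤ⇒∣)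
  inverse { -[1+ n ]} p∤a with inverse-ℕ {suc n} (p∤a ∘ ∣ᵤ⇒∣)
  ... | w , nw≈1 = - w , ≈-trans (≈-reflexive (identity (+ suc n) w)) nw≈1
    where identity : ∀ a w → - a * - w ≡ a * w
          identity = solve-∀

  ≈%ℕ : ∀ a → a ≈ + (a %ℕ p)
  ≈%ℕ a = ≡+*⇒≈ (a /ℕ p) (a≡a%ℕn+[a/ℕn]*n a p)

  %≈ : ∀ n → + (n ℕ.% p) ≈ + n
  %≈ n = ≈-sym (≡+*⇒≈ (+ (n ℕ./ p)) (begin
    + n                                     ≡⟨ cong +_ (m≡m%n+[m/n]*n n p) ⟩
    + (n ℕ.% p ℕ.+ n ℕ./ p ℕ.* p)           ≡⟨ ℤ.pos-+ (n ℕ.% p) _ ⟩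
    + (n ℕ.% p) + + (n ℕ./ p ℕ.* p)         ≡⟨ cong (_+_ (+ (n ℕ.% p))) (ℤ.pos-* (n ℕ./ p) p) ⟩
    + (n ℕ.% p) + + (n ℕ./ p) * + p         ∎))
    where open ≡-Reasoning

  ∣∧∣i∣<p⇒i≡0 : ∀ {i} → + p ∣ᶻ i → ∣ i ∣ ℕ.< p → i ≡ + 0
  ∣∧∣i∣<p⇒i≡0 {i} p∣i ∣i∣<p = ℤ.∣i∣≡0⇒i≡0 (small (∣⇒∣ᵤ p∣i) ∣i∣<p)
    where small : ∀ {k} → p ∣ k → k ℕ.< p → k ≡ 0
          small {zero}  _   _   = refl
          small {suc k} p∣k k<p = contradiction p∣k (ℕ∣.>⇒∤ k<p)

  residue-unique : ∀ {m n} → m ℕ.< p → n ℕ.< p → + m ≈ + n → m ≡ n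
  residue-unique {m} {n} m<p n<p (mk≈ p∣m-n) =
    ℤ.+-injective (ℤ.i-j≡0⇒i≡j (+ m) (+ n) (∣∧∣i∣<p⇒i≡0 p∣m-n ∣m-n∣<p))
    where ∣m-n∣<p : ∣ + m - + n ∣ ℕ.< p
          ∣m-n∣<p = subst (ℕ._< p) (cong ∣_∣ (sym (ℤ.m-n≡m⊖n m n)))
                      (ℕ.≤-<-trans (ℤ.∣m⊝n∣≤m⊔n m n) (ℕ.⊔-lub m<p n<p))

  %ℕ-cong : ∀ {a b} → a ≈ b → a %ℕ p ≡ b %ℕ p
  %ℕ-cong {a} {b} a≈b = residue-unique (n%ℕd<d a p) (n%ℕd<d b p) (begin
    + (a %ℕ p) ≈⟨ ≈%ℕ a ⟨
    a          ≈⟨ a≈b ⟩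
    b          ≈⟨ ≈%ℕ b ⟩
    + (b %ℕ p) ∎)
    where open ≈-Reasoning

  %ℕ≡0⇒∣ : ∀ {a} → a %ℕ p ≡ 0 → + p ∣ᶻ a
  %ℕ≡0⇒∣ {a} a%p≡0 = ≈0⇒∣ (≈-trans (≈%ℕ a) (≈-reflexive (cong +_ a%p≡0)))

  IsSquare : ℤ → Set
  IsSquare a = ∃ λ y → a ≈ y * y

  square-cancel : ∀ {a b} → ¬ + p ∣ᶻ a → IsSquare a → IsSquare (a * b) → IsSquare b
  square-cancel {a} {b} p∤a (x , a≈x²) (y , ab≈y²) = y * w , (begin
    b                         ≡⟨ ℤ.*-identityʳ b ⟨
    b * + 1                   ≈⟨ *-cong (≈-refl {b}) (≈-sym (*-cong xw≈1 xw≈1)) ⟩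
    b * ((x * w) * (x * w))   ≡⟨ regroup b x w ⟩
    ((x * x) * b) * (w * w)   ≈⟨ *-cong (*-cong (≈-sym a≈x²) (≈-refl {b})) (≈-refl {w * w}) ⟩
    (a * b) * (w * w)         ≈⟨ *-cong ab≈y² (≈-refl {w * w}) ⟩
    (y * y) * (w * w)         ≡⟨ regroup′ y w ⟩
    (y * w) * (y * w)         ∎)
    where
    open ≈-Reasoning
    p∤x : ¬ + p ∣ᶻ x
    p∤x p∣x = p∤a (∣-resp-≈ a≈x² (ℤ∣.∣m⇒∣m*n x p∣x))
    w = proj₁ (inverse p∤x)
    xw≈1 = proj₂ (inverse p∤x)
    regroup : ∀ b x w → b * ((x * w) * (x * w)) ≡ ((x * x) * b) * (w * w)
    regroup = solve-∀
    regroup′ : ∀ y w → (y * y) * (w * w) ≡ (y * w) * (y * w)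
    regroup′ = solve-∀

  isSquareResidue : ℕ → Bool
  isSquareResidue r = any (λ y → ((y ℕ.* y) ℕ.% p) ≡ᵇ r) (upTo p)

  isSquareResidue-sound : ∀ {a} → T (isSquareResidue (a %ℕ p)) → IsSquare a
  isSquareResidue-sound {a} t with satisfied (any⁻ _ (upTo p) t)
  ... | y , y²%p≡a%p = + y , (begin
    a                       ≈⟨ ≈%ℕ a ⟩
    + (a %ℕ p)              ≡⟨ cong +_ (ℕ.≡ᵇ⇒≡ _ _ y²%p≡a%p) ⟨
    + ((y ℕ.* y) ℕ.% p)     ≈⟨ %≈ (y ℕ.* y) ⟩
    + (y ℕ.* y)             ≡⟨ ℤ.pos-* y y ⟩
    + y * + y               ∎)
    where open ≈-Reasoning

  isSquareResidue-complete : ∀ {a} → IsSquare a → T (isSquareResidue (a %ℕ p))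
  isSquareResidue-complete {a} (y , a≈y²) =
    any⁺ _ (lose (∈-upTo⁺ (n%ℕd<d y p)) (ℕ.≡⇒≡ᵇ _ _ y′²%p≡a%p))
    where
    y′ = y %ℕ p
    y′²%p≡a%p : (y′ ℕ.* y′) ℕ.% p ≡ a %ℕ p
    y′²%p≡a%p = residue-unique (m%n<n _ p) (n%ℕd<d a p) (begin
      + ((y′ ℕ.* y′) ℕ.% p)  ≈⟨ %≈ (y′ ℕ.* y′) ⟩
      + (y′ ℕ.* y′)          ≡⟨ ℤ.pos-* y′ y′ ⟩
      + y′ * + y′            ≈⟨ *-cong (≈%ℕ y) (≈%ℕ y) ⟨
      y * y                  ≈⟨ a≈y² ⟨
      a                      ≈⟨ ≈%ℕ a ⟩
      + (a %ℕ p)             ∎)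
      where open ≈-Reasoning

  -- The body of `legendre`: symbol (a * b) is the Legendre symbol of a / b.
  symbolOfResidue : ℕ → ℤ
  symbolOfResidue r = if r ≡ᵇ 0 then + 0 else if isSquareResidue r then + 1 else -[1+ 0 ]

  symbol : ℤ → ℤ
  symbol a = symbolOfResidue (a %ℕ p)

  symbol-cong : ∀ {a b} → a ≈ b → symbol a ≡ symbol b
  symbol-cong a≈b = cong symbolOfResidue (%ℕ-cong a≈b)

  symbol≡0⇒∣ : ∀ {a} → symbol a ≡ + 0 → + p ∣ᶻ a
  symbol≡0⇒∣ {a} symbol≡0 = %ℕ≡0⇒∣ (residue≡0 (a %ℕ p) symbol≡0)
    where residue≡0 : ∀ r → symbolOfResidue r ≡ + 0 → r ≡ 0
          residue≡0 zero    _ = refl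
          residue≡0 (suc r) _ with isSquareResidue (suc r)
          residue≡0 (suc r) () | true
          residue≡0 (suc r) () | false

  symbol-unit : ∀ {a} → ¬ + p ∣ᶻ a → symbol a ≡ (if isSquareResidue (a %ℕ p) then + 1 else -[1+ 0 ])
  symbol-unit {a} p∤a with a %ℕ p in a%p
  ... | zero  = contradiction (%ℕ≡0⇒∣ a%p) p∤a
  ... | suc r = refl

  symbol-square : ∀ {a} → ¬ + p ∣ᶻ a → IsSquare a → symbol a ≡ + 1
  symbol-square {a} p∤a a-square =
    trans (symbol-unit p∤a) (cong (if_then + 1 else -[1+ 0 ]) (Equivalence.to T-≡ (isSquareResidue-complete a-square)))

  symbol-resp-square : ∀ {a b} → ¬ + p ∣ᶻ a → ¬ + p ∣ᶻ b → IsSquare (a * b) → symbol a ≡ symbol b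
  symbol-resp-square {a} {b} p∤a p∤b ab-square = begin
    symbol a                                                   ≡⟨ symbol-unit p∤a ⟩
    (if isSquareResidue (a %ℕ p) then + 1 else -[1+ 0 ])
      ≡⟨ cong (if_then + 1 else -[1+ 0 ]) (T-injective a⇒b b⇒a) ⟩
    (if isSquareResidue (b %ℕ p) then + 1 else -[1+ 0 ])       ≡⟨ symbol-unit p∤b ⟨
    symbol b                                                   ∎
    where
    open ≡-Reasoning
    a⇒b : T (isSquareResidue (a %ℕ p)) → T (isSquareResidue (b %ℕ p))
    a⇒b t = isSquareResidue-complete (square-cancel p∤a (isSquareResidue-sound t) ab-square)
    b⇒a : T (isSquareResidue (b %ℕ p)) → T (isSquareResidue (a %ℕ p))
    b⇒a t = isSquareResidue-complete
              (square-cancel p∤b (isSquareResidue-sound t) (subst IsSquare (ℤ.*-comm a b) ab-square))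

legendre≡symbol : ∀ {p} (p-prime : Prime p) x → legendre x p ≡ ModPrime.symbol p p-prime (↥ x * ↧ x)
legendre≡symbol {zero}  p-prime x = ⊥-elim (ℕ.NonZero.nonZero (prime⇒nonZero p-prime))
legendre≡symbol {suc _} p-prime x = refl

module Reduction (p : ℕ) (p-prime : Prime p) where

  open import Data.Integer using (_+_; _-_)

  open ModPrime p p-prime

  infix 4 _↦_
  record _↦_ (x : ℚ) (a : ℤ) : Set where
    constructor reduces
    field
      p∤↧ : ¬ + p ∣ᶻ ↧ x
      ↥≈  : ↥ x ≈ a * ↧ x

  ↦-resp-≈ : ∀ {x a b} → a ≈ b → x ↦ a → x ↦ b
  ↦-resp-≈ {x} a≈b (reduces p∤↧ ↥≈) = reduces p∤↧ (≈-trans ↥≈ (*-cong a≈b (≈-refl {↧ x})))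

  ↦-integer : ∀ {x} → ↧ x ≡ + 1 → x ↦ ↥ x
  ↦-integer {x} ↧≡1 = reduces p∤↧ (≈-reflexive (sym (trans (cong (↥ x *_) ↧≡1) (ℤ.*-identityʳ (↥ x)))))
    where p∤↧ : ¬ + p ∣ᶻ ↧ x
          p∤↧ p∣↧ = p∤1 (subst (+ p ∣ᶻ_) ↧≡1 p∣↧)

  -- x is i / n up to the common factor g that normalisation cancels.
  ↦-cancel : ∀ {x a g i n} → ↥ x * g ≡ i → ↧ x * g ≡ n → ¬ + p ∣ᶻ n → i ≈ a * n → x ↦ a
  ↦-cancel {x} {a} {g} {i} {n} ↥g≡i ↧g≡n p∤n (mk≈ p∣i-an) = reduces p∤↧ (mk≈ p∣↥-a↧)
    where
    p∤↧ : ¬ + p ∣ᶻ ↧ x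
    p∤↧ p∣↧ = p∤n (subst (+ p ∣ᶻ_) ↧g≡n (ℤ∣.∣m⇒∣m*n g p∣↧))
    g[↥-a↧]≡i-an : g * (↥ x - a * ↧ x) ≡ i - a * n
    g[↥-a↧]≡i-an = begin
      g * (↥ x - a * ↧ x)       ≡⟨ identity g (↥ x) (↧ x) a ⟩
      ↥ x * g - a * (↧ x * g)   ≡⟨ cong₂ (λ s t → s - a * t) ↥g≡i ↧g≡n ⟩
      i - a * n                 ∎
      where open ≡-Reasoning
            identity : ∀ g y z a → g * (y - a * z) ≡ y * g - a * (z * g)
            identity = solve-∀
    p∣↥-a↧ : + p ∣ᶻ ↥ x - a * ↧ x
    p∣↥-a↧ with ∣-* (subst (+ p ∣ᶻ_) (sym g[↥-a↧]≡i-an) p∣i-an)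
    ... | inj₁ p∣g = contradiction (subst (+ p ∣ᶻ_) ↧g≡n (ℤ∣.∣n⇒∣m*n (↧ x) p∣g)) p∤n
    ... | inj₂ p∣↥-a↧ = p∣↥-a↧

  ↦-/ : ∀ {a} i n .{{_ : ℕ.NonZero n}} → ¬ + p ∣ᶻ + n → i ≈ a * + n → i / n ↦ a
  ↦-/ i n = ↦-cancel (↥-/ i n) (↧-/ i n)

  private
    p∤↧*↧ : ∀ {x y a b} → x ↦ a → y ↦ b → ¬ + p ∣ᶻ + (↧ₙ x ℕ.* ↧ₙ y)
    p∤↧*↧ {x} {y} (reduces p∤↧x _) (reduces p∤↧y _) =
      ∤-* p∤↧x p∤↧y ∘ subst (+ p ∣ᶻ_) (ℤ.pos-* (↧ₙ x) (↧ₙ y))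

  ↦-+ : ∀ {x y a b} → x ↦ a → y ↦ b → x ℚ.+ y ↦ a + b
  ↦-+ {x@record{}} {y@record{}} {a} {b} x↦a@(reduces _ ↥x≈) y↦b@(reduces _ ↥y≈) =
    ↦-/ _ (↧ₙ x ℕ.* ↧ₙ y) (p∤↧*↧ x↦a y↦b) (begin
      ↥ x * ↧ y + ↥ y * ↧ x
        ≈⟨ +-cong (*-cong ↥x≈ (≈-refl {↧ y})) (*-cong ↥y≈ (≈-refl {↧ x})) ⟩
      a * ↧ x * ↧ y + b * ↧ y * ↧ x          ≡⟨ identity a b (↧ x) (↧ y) ⟩
      (a + b) * (↧ x * ↧ y)                  ≡⟨ cong ((a + b) *_) (ℤ.pos-* (↧ₙ x) (↧ₙ y)) ⟨
      (a + b) * + (↧ₙ x ℕ.* ↧ₙ y)            ∎)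
    where open ≈-Reasoning
          identity : ∀ a b X Y → a * X * Y + b * Y * X ≡ (a + b) * (X * Y)
          identity = solve-∀

  ↦-* : ∀ {x y a b} → x ↦ a → y ↦ b → x ℚ.* y ↦ a * b
  ↦-* {x@record{}} {y@record{}} {a} {b} x↦a@(reduces _ ↥x≈) y↦b@(reduces _ ↥y≈) =
    ↦-/ _ (↧ₙ x ℕ.* ↧ₙ y) (p∤↧*↧ x↦a y↦b) (begin
      ↥ x * ↥ y                              ≈⟨ *-cong ↥x≈ ↥y≈ ⟩
      a * ↧ x * (b * ↧ y)                    ≡⟨ identity a b (↧ x) (↧ y) ⟩
      (a * b) * (↧ x * ↧ y)                  ≡⟨ cong ((a * b) *_) (ℤ.pos-* (↧ₙ x) (↧ₙ y)) ⟨
      (a * b) * + (↧ₙ x ℕ.* ↧ₙ y)            ∎)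
    where open ≈-Reasoning
          identity : ∀ a b X Y → a * X * (b * Y) ≡ (a * b) * (X * Y)
          identity = solve-∀

  ↦-neg : ∀ {x a} → x ↦ a → ℚ.- x ↦ - a
  ↦-neg {x} {a} (reduces p∤↧ ↥≈) =
    reduces (subst (λ d → ¬ + p ∣ᶻ d) (sym (↧-neg x)) p∤↧) (begin
      ↥ (ℚ.- x)      ≡⟨ ↥-neg x ⟩
      - ↥ x          ≈⟨ neg-cong ↥≈ ⟩
      - (a * ↧ x)    ≡⟨ ℤ.neg-distribˡ-* a (↧ x) ⟩
      - a * ↧ x      ≡⟨ cong (- a *_) (↧-neg x) ⟨
      - a * ↧ (ℚ.- x) ∎)
    where open ≈-Reasoning

  ↦-sub : ∀ {x y a b} → x ↦ a → y ↦ b → x ℚ.- y ↦ a - b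
  ↦-sub x↦a y↦b = ↦-+ x↦a (↦-neg y↦b)

  ↦-U : ∀ {q r} → q ↦ r → ∀ n → U n q ↦ u n r
  ↦-U q↦r zero          = ↦-integer refl
  ↦-U q↦r (suc zero)    = ↦-integer refl
  ↦-U q↦r (suc (suc n)) = ↦-sub (↦-* q↦r (↦-U q↦r (suc n))) (↦-U q↦r n)

  ↦-C : ∀ {q r} → q ↦ r → ∀ n → C n q ↦ c n r
  ↦-C q↦r zero    = ↦-integer refl
  ↦-C q↦r (suc n) = ↦-sub (↦-U q↦r (2 ℕ.+ n)) (↦-U q↦r n)

  ↦-V : ∀ {q r} → q ↦ r → ∀ k → V' k q ↦ u (suc k) r - u k r
  ↦-V q↦r k = ↦-sub (↦-U q↦r (suc k)) (↦-U q↦r k)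

  ↦-W : ∀ {q r} → q ↦ r → ∀ k → W' k q ↦ u (suc k) r + u k r
  ↦-W q↦r k = ↦-+ (↦-U q↦r (suc k)) (↦-U q↦r k)

  ↦-exists : ∀ {q} → ¬ InD p q → ∃ λ r → q ↦ r
  ↦-exists {q} p∉𝒟 = ↥ q * w , reduces p∤↧ (begin
    ↥ q                ≡⟨ ℤ.*-identityʳ (↥ q) ⟨
    ↥ q * + 1          ≈⟨ *-cong (≈-refl {↥ q}) (≈-sym ↧w≈1) ⟩
    ↥ q * (↧ q * w)    ≡⟨ identity (↥ q) (↧ q) w ⟩
    ↥ q * w * ↧ q      ∎)
    where
    open ≈-Reasoning
    p∤↧ : ¬ + p ∣ᶻ ↧ q
    p∤↧ = p∉𝒟 ∘ ∣⇒∣ᵤ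
    w = proj₁ (inverse p∤↧)
    ↧w≈1 = proj₂ (inverse p∤↧)
    identity : ∀ a d w → a * (d * w) ≡ a * w * d
    identity = solve-∀

  ↦-≡0mod : ∀ {x a} → x ↦ a → + p ∣ᶻ a → ≡0mod x p
  ↦-≡0mod {x} (reduces _ ↥≈) p∣a = ∣⇒∣ᵤ (∣-resp-≈ ↥≈ (ℤ∣.∣m⇒∣m*n (↧ x) p∣a))

  ≡0mod-↦ : ∀ {x a} → x ↦ a → ≡0mod x p → + p ∣ᶻ a
  ≡0mod-↦ {x} {a} (reduces p∤↧ ↥≈) p∣↥ with ∣-* (∣-resp-≈ (≈-sym ↥≈) (∣ᵤ⇒∣ p∣↥))
  ... | inj₁ p∣a = p∣a
  ... | inj₂ p∣↧ = contradiction p∣↧ p∤↧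

  legendre-↦ : ∀ {x a} → x ↦ a → ¬ + p ∣ᶻ a → legendre x p ≡ symbol a
  legendre-↦ {x} {a} (reduces p∤↧ ↥≈) p∤a = begin
    legendre x p              ≡⟨ legendre≡symbol p-prime x ⟩
    symbol (↥ x * ↧ x)        ≡⟨ symbol-cong (*-cong ↥≈ (≈-refl {↧ x})) ⟩
    symbol (a * ↧ x * ↧ x)    ≡⟨ symbol-resp-square (∤-* (∤-* p∤a p∤↧) p∤↧) p∤a (a * ↧ x , ≈-reflexive (regroup a (↧ x))) ⟩
    symbol a                  ∎
    where open ≡-Reasoning
          regroup : ∀ a d → a * d * d * a ≡ (a * d) * (a * d)
          regroup = solve-∀

  legendre≡0-↦ : ∀ {x a} → x ↦ a → legendre x p ≡ + 0 → + p ∣ᶻ a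
  legendre≡0-↦ {x} x↦a@(reduces p∤↧ _) legendre≡0
    with ∣-* {↥ x} {↧ x} (symbol≡0⇒∣ (trans (sym (legendre≡symbol p-prime x)) legendre≡0))
  ... | inj₁ p∣↥ = ≡0mod-↦ x↦a (∣⇒∣ᵤ p∣↥)
  ... | inj₂ p∣↧ = contradiction p∣↧ p∤↧

module Proposition12 {p} (p-prime : Prime p) (2∤p : ¬ 2 ∣ p) {q r} (q↦r : Reduction._↦_ p p-prime q r) where

  open import Data.Integer using (_+_; _-_)

  open ModPrime p p-prime
  open Reduction p p-prime

  private
    p∤2 : ¬ + p ∣ᶻ + 2
    p∤2 = odd⇒p∤2 2∤p

    2↦2 : + 2 / 1 ↦ + 2
    2↦2 = ↦-integer refl

    q↦2 : + p ∣ᶻ + 2 - r → q ↦ + 2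
    q↦2 p∣2-r = ↦-resp-≈ (≈-sym (mk≈ p∣2-r)) q↦r

    q↦−2 : + p ∣ᶻ + 2 + r → q ↦ - + 2
    q↦−2 p∣2+r = ↦-resp-≈ (mk≈ (subst (+ p ∣ᶻ_) (identity r) p∣2+r)) q↦r
      where identity : ∀ r → + 2 + r ≡ r - - + 2
            identity = solve-∀

    half = proj₁ (odd-of-¬2∣ 2∤p)

    p∣odd[half] : + p ∣ᶻ + odd half
    p∣odd[half] = ℤ∣.∣-reflexive (cong +_ (proj₂ (odd-of-¬2∣ 2∤p)))

  Π₂₊[1+k]⇒legendre[2]≡1 : ∀ {k} → Π₂₊ (suc k) q p → legendre (+ 2 / 1) p ≡ + 1
  Π₂₊[1+k]⇒legendre[2]≡1 {k} (m , C≡0) =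
    trans (legendre-↦ 2↦2 p∤2) (symbol-square p∤2 (c M r , 2≈c[M]²))
    where
    M = 2 ℕ.^ k ℕ.* odd m
    p∣c[2M] : + p ∣ᶻ c (2 ℕ.* M) r
    p∣c[2M] = ≡0mod-↦ (↦-C q↦r (2 ℕ.* M))
                (subst (λ n → ≡0mod (C n q) p) (ℕ.*-assoc 2 (2 ℕ.^ k) (odd m)) C≡0)
    2≈c[M]² : + 2 ≈ c M r * c M r
    2≈c[M]² = begin
      + 2                   ≈⟨ +∣≈ p∣c[2M] ⟨
      + 2 + c (2 ℕ.* M) r   ≡⟨ ℤ.+-comm (+ 2) (c (2 ℕ.* M) r) ⟩
      c (2 ℕ.* M) r + + 2   ≡⟨ c[n]²≡c[2n]+2 M r ⟨
      c M r * c M r         ∎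
      where open ≈-Reasoning

  module _ (m : ℕ) (C≡0 : ≡0mod (C (odd m) q) p) where

    private
      p∣c : ∀ {s} → q ↦ s → + p ∣ᶻ c (odd m) s
      p∣c q↦s = ≡0mod-↦ (↦-C q↦s (odd m)) C≡0

      -- C_n(2) = 2 and C_n(-2) = ±2 are units, so r ≢ ±2.
      p∤2-r : ¬ + p ∣ᶻ + 2 - r
      p∤2-r p∣2-r = p∤2 (subst (+ p ∣ᶻ_) (c-at-2 (odd m)) (p∣c (q↦2 p∣2-r)))

      p∤2+r : ¬ + p ∣ᶻ + 2 + r
      p∤2+r p∣2+r with c-at-−2 (odd m)
      ... | s , s²≡1 , c≡2s = p∤2 (subst (+ p ∣ᶻ_) s[s2]≡2 (ℤ∣.∣n⇒∣m*n s p∣2s))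
        where
        p∣2s : + p ∣ᶻ s * + 2
        p∣2s = subst (+ p ∣ᶻ_) c≡2s (p∣c (q↦−2 p∣2+r))
        s[s2]≡2 : s * (s * + 2) ≡ + 2
        s[s2]≡2 = trans (sym (ℤ.*-assoc s s (+ 2))) (cong (_* + 2) s²≡1)

      2[2+r]-square : IsSquare (+ 2 * (+ 2 + r))
      2[2+r]-square = c (suc m) r + c m r , (begin
        + 2 * (+ 2 + r)                               ≈⟨ +∣≈ (ℤ∣.∣n⇒∣m*n (r + + 2) (p∣c q↦r)) ⟨
        + 2 * (+ 2 + r) + (r + + 2) * c (odd m) r     ≡⟨ c-sum-square m r ⟨
        (c (suc m) r + c m r) * (c (suc m) r + c m r) ∎)
        where open ≈-Reasoning

      2[2-r]-square : IsSquare (+ 2 * (+ 2 - r))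
      2[2-r]-square = c (suc m) r - c m r , (begin
        + 2 * (+ 2 - r)                               ≈⟨ +∣≈ (ℤ∣.∣n⇒∣m*n (r - + 2) (p∣c q↦r)) ⟨
        + 2 * (+ 2 - r) + (r - + 2) * c (odd m) r     ≡⟨ c-difference-square m r ⟨
        (c (suc m) r - c m r) * (c (suc m) r - c m r) ∎)
        where open ≈-Reasoning

    legendre[2]≡legendre[2+q] : legendre (+ 2 / 1) p ≡ legendre (+ 2 / 1 ℚ.+ q) p
    legendre[2]≡legendre[2+q] = begin
      legendre (+ 2 / 1) p          ≡⟨ legendre-↦ 2↦2 p∤2 ⟩
      symbol (+ 2)                  ≡⟨ symbol-resp-square p∤2 p∤2+r 2[2+r]-square ⟩
      symbol (+ 2 + r)              ≡⟨ legendre-↦ (↦-+ 2↦2 q↦r) p∤2+r ⟨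
      legendre (+ 2 / 1 ℚ.+ q) p    ∎
      where open ≡-Reasoning

    legendre[2]≡legendre[2-q] : legendre (+ 2 / 1) p ≡ legendre (+ 2 / 1 ℚ.- q) p
    legendre[2]≡legendre[2-q] = begin
      legendre (+ 2 / 1) p          ≡⟨ legendre-↦ 2↦2 p∤2 ⟩
      symbol (+ 2)                  ≡⟨ symbol-resp-square p∤2 p∤2-r 2[2-r]-square ⟩
      symbol (+ 2 - r)              ≡⟨ legendre-↦ (↦-sub 2↦2 q↦r) p∤2-r ⟨
      legendre (+ 2 / 1 ℚ.- q) p    ∎
      where open ≡-Reasoning

  Π₂⇒legendre-equal : Π₂₊ 0 q p → legendre (+ 2 / 1) p ≡ legendre (+ 2 / 1 ℚ.+ q) p
                                × legendre (+ 2 / 1 ℚ.+ q) p ≡ legendre (+ 2 / 1 ℚ.- q) p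
  Π₂⇒legendre-equal (m , C≡0) =
    legendre[2]≡legendre[2+q] m C≡0′ ,
    trans (sym (legendre[2]≡legendre[2+q] m C≡0′)) (legendre[2]≡legendre[2-q] m C≡0′)
    where C≡0′ : ≡0mod (C (odd m) q) p
          C≡0′ = subst (λ n → ≡0mod (C n q) p) (ℕ.*-identityˡ (odd m)) C≡0

  legendre[2+q]≡0⇒Π₁ : legendre (+ 2 / 1 ℚ.+ q) p ≡ + 0 → Π₁ q p
  legendre[2+q]≡0⇒Π₁ legendre≡0 with V-at-−2 half
  ... | s , V[−2]≡s*p = half , ↦-≡0mod (↦-V q↦−2′ half) p∣V[−2]
    where
    q↦−2′ = q↦−2 (legendre≡0-↦ (↦-+ 2↦2 q↦r) legendre≡0)
    p∣V[−2] : + p ∣ᶻ u (suc half) (- + 2) - u half (- + 2)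
    p∣V[−2] = subst (+ p ∣ᶻ_) (sym V[−2]≡s*p) (ℤ∣.∣n⇒∣m*n s p∣odd[half])

  legendre[2-q]≡0⇒Π₀ : legendre (+ 2 / 1 ℚ.- q) p ≡ + 0 → Π₀ q p
  legendre[2-q]≡0⇒Π₀ legendre≡0 =
    half , ↦-≡0mod (↦-W q↦2′ half) (subst (+ p ∣ᶻ_) (sym (W-at-2 half)) p∣odd[half])
    where q↦2′ = q↦2 (legendre≡0-↦ (↦-sub 2↦2 q↦r) legendre≡0)

open import Data.Rational using (_+_; _-_)

proposition12 : (q : ℚ) (p : ℕ) → Prime p → ¬ (2 ∣ p) → ¬ InD p q →
    ((Π* q p → ¬ Π₂₊ 0 q p → legendre (+ 2 / 1) p ≡ + 1)
    × (Π₂₊ 0 q p → (legendre (+ 2 / 1) p ≡ legendre (+ 2 / 1 + q) p)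
                 × (legendre (+ 2 / 1 + q) p ≡ legendre (+ 2 / 1 - q) p))
    × (legendre (+ 2 / 1 + q) p ≡ + 0 → Π₁ q p)
    × (legendre (+ 2 / 1 - q) p ≡ + 0 → Π₀ q p))
proposition12 q p p-prime 2∤p p∉𝒟 =
  Π*∖Π₂⇒legendre[2]≡1 , Π₂⇒legendre-equal , legendre[2+q]≡0⇒Π₁ , legendre[2-q]≡0⇒Π₀
  where
  open Proposition12 p-prime 2∤p (proj₂ (Reduction.↦-exists p p-prime {q} p∉𝒟))
  Π*∖Π₂⇒legendre[2]≡1 : Π* q p → ¬ Π₂₊ 0 q p → legendre (+ 2 / 1) p ≡ + 1
  Π*∖Π₂⇒legendre[2]≡1 (zero  , Π₂)   ∉Π₂ = contradiction Π₂ ∉Π₂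
  Π*∖Π₂⇒legendre[2]≡1 (suc k , Π₂₊ₖ) _   = Π₂₊[1+k]⇒legendre[2]≡1 {k} Π₂₊ₖ
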